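{- For each integer $d\ge 0$, there exist $4^{d+1}$ pairwise disjoint Breaker pairing strategies for $\mathcal{Q}(3^{d+1},3^d+1)$, all of the same cardinality, whose union is the set of all edges of $Q_{3^{d+1}}$.
   Context: $Q_n$ is the hypercube graph on $\{0,1\}^n$ (vertices adjacent iff they differ in exactly one coordinate). A $k$-dimensional subcube of $Q_n$ is obtained by choosing $n-k$ coordinates and fixed values in $\{0,1\}$ for them, and taking all $2^k$ vectors agreeing with these fixed values. $\mathcal{Q}(n,k)$ is the hypergraph with vertex set $\{0,1\}^n$ whose edges are the $k$-dimensional subcubes of $Q_n$ (the Maker–Breaker game is played on it). Following the paper's convention, a Breaker pairing strategy for $\mathcal{Q}(n,k)$ is a matching $M$ in $Q_n$ (a set of pairwise disjoint edges) such that every $k$-dimensional subcube of $Q_n$ contains both endpoints of at least one edge of $M$. -}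

module Defs where

open import Data.Nat using (ℕ; zero; suc)
open import Data.Bool using (Bool; true; false)
open import Data.Maybe using (Maybe; just; nothing)
open import Data.Fin using (Fin)
open import Data.Vec using (Vec; []; _∷_; lookup; _[_]≔_)
open import Data.List using (List; length)
open import Data.List.Membership.Propositional using (_∈_)
open import Data.List.Relation.Unary.AllPairs using (AllPairs)
open import Data.Product using (_×_; ∃)
open import Data.Sum using (_⊎_)
open import Relation.Binary.PropositionalEquality using (_≡_; _≢_)
open import Relation.Nullary using (¬_)

Vertex : ℕ → Set
Vertex n = Vec Bool n

-- An edge of Q_n, represented canonically by its lower endpoint `base`
-- and the coordinate `dir` in which its two endpoints differ
-- (base has 0 in coordinate dir). This is a bijection with edges of Q_n.
record Edge (n : ℕ) : Set where
  constructor edge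
  field
    base : Vertex n
    dir  : Fin n
    low  : lookup base dir ≡ false

open Edge public

lowEnd : ∀ {n} → Edge n → Vertex n
lowEnd e = base e

highEnd : ∀ {n} → Edge n → Vertex n
highEnd e = base e [ dir e ]≔ true

ShareVertex : ∀ {n} → Edge n → Edge n → Set
ShareVertex e f =
  (lowEnd e ≡ lowEnd f) ⊎ (lowEnd e ≡ highEnd f) ⊎ (highEnd e ≡ lowEnd f) ⊎ (highEnd e ≡ highEnd f)

-- A matching: a finite list of pairwise (vertex-)disjoint edges.
-- (Since an edge shares vertices with itself, the list has no repetitions,
-- so its length is the cardinality of the matching.)
IsMatching : ∀ {n} → List (Edge n) → Set
IsMatching M = AllPairs (λ e f → ¬ ShareVertex e f) M

-- A subcube of Q_n: for each coordinate, either `nothing` (free) or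
-- `just b` (fixed to value b).
Subcube : ℕ → Set
Subcube n = Vec (Maybe Bool) n

dim : ∀ {n} → Subcube n → ℕ
dim [] = zero
dim (nothing ∷ s) = suc (dim s)
dim (just _ ∷ s) = dim s

_∈ₛ_ : ∀ {n} → Vertex n → Subcube n → Set
v ∈ₛ S = ∀ i b → lookup S i ≡ just b → lookup v i ≡ b

IsPairingStrategy : (n k : ℕ) → List (Edge n) → Set
IsPairingStrategy n k M =
  IsMatching M ×
  (∀ (S : Subcube n) → dim S ≡ k →
     ∃ λ e → e ∈ M × (lowEnd e ∈ₛ S) × (highEnd e ∈ₛ S))

module Submission where

-- Write the vertices of Q_{3^m} as triples of vertices of Q_{3^(m-1)} and label them recursively by
-- words in F₄^m: the first letter of L(x₁x₂x₃) is p₁ + p₂ω + p₃ω², where p_j is the parity of x_j,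
-- and the remaining letters are L(x₁) + L(x₂) + L(x₃). An edge with odd end u and even end u' gets
-- the label ω²L(u) + ωL(u'), and the 4^m strategies are the classes of edges with a given label.
-- A class is a matching because L is injective on the neighbours of any vertex: the first letter
-- determines the block of the flipped coordinate. A class meets every subcube S with
-- 3 dim S > 3^m, by induction on m: for every parity and label there is such an edge (and, when
-- 3 dim S > 2·3^m, such a vertex) in S, obtained either from an edge in a block of large dimension,
-- or, when one block of S is a single point, from an edge in one block and a vertex of suitable
-- label in another. Since L is F₂-linear, translating by an even vertex of label s maps the class of
-- 0 bijectively onto the class of s, so all classes have the same size.

open import Defs

open import Algebra.Bundles using (CommutativeSemigroup)
import Algebra.Properties.CommutativeSemigroup as CommutativeSemigroupProperties
open import Data.Bool using (Bool; true; false; not; _xor_; if_then_else_)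
import Data.Bool as Bool
open import Data.Bool.Properties
  using (xor-assoc; xor-comm; xor-same; xor-identityʳ; not-distribˡ-xor; not-distribʳ-xor; not-involutive; ¬-not)
open import Data.Nat using (ℕ; zero; suc; _+_; _*_; _^_; _≤_; _<_; z≤n; s≤s; z<s)
open import Data.Nat.Properties
  using ( +-commutativeSemigroup; +-identityʳ; m≤n⇒m≤1+n; _<?_; ≮⇒≥; ≤⇒≯; *-monoʳ-<; *-distribˡ-+; +-mono-≤
        ; +-monoˡ-≤; +-cancelˡ-<; +-comm; *-cancelˡ-<; *-assoc; ≤-trans; m≤m+n; m<n+m; m<m+n; m^n>0; module ≤-Reasoning)
open import Function using (_∘_)
open import Data.Product using (Σ; _×_; _,_; proj₁; proj₂; uncurry; curry; ∃; ∃₂)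
open import Data.Product.Properties using (≡-dec)
open import Data.Empty using (⊥; ⊥-elim)
open import Data.Maybe using (just; nothing)
open import Data.Sum using (_⊎_; inj₁; inj₂; [_,_]′)
open import Data.Vec using (Vec; []; _∷_; _++_; zipWith; replicate)
open import Data.Vec.Properties renaming (≡-dec to ≡-decᵥ)
  using (∷-injective; ∷-injectiveʳ; zipWith-assoc; zipWith-comm; zipWith-identityˡ; zipWith-identityʳ; zipWith-++)
open import Data.Fin using (Fin; zero; suc)
import Data.Fin as Fin
open import Data.Fin.Properties using (remQuot-combine; combine-remQuot)
open import Data.List using (List; length; filter; deduplicate)
open import Data.List.Properties using (length-map)
import Data.List as List
open import Data.List.Membership.Propositional using (_∈_)
open import Data.List.Membership.Propositional.Properties
  using (∈-map⁺; ∈-map⁻; ∈-++⁺ˡ; ∈-++⁺ʳ; ∈-filter⁺; ∈-filter⁻; ∈-deduplicate⁺; ∈-deduplicate⁻)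
open import Data.List.Relation.Unary.All using (All; []; _∷_)
import Data.List.Relation.Unary.All as All
open import Data.List.Relation.Unary.Any using (here)
open import Data.List.Relation.Unary.AllPairs using (AllPairs; []; _∷_)
open import Data.List.Relation.Unary.Unique.Propositional using (Unique)
open import Data.List.Relation.Unary.Unique.Propositional.Properties using (map⁺)
open import Data.List.Relation.Unary.Unique.DecPropositional.Properties using (deduplicate-!)
open import Axiom.UniquenessOfIdentityProofs using (module Decidable⇒UIP)
open import Relation.Binary using (DecidableEquality)
open import Relation.Binary.PropositionalEquality
open import Relation.Nullary using (Dec; yes; no; contradiction)
open import Relation.Nullary.Decidable using (from-yes; map′; _×-dec_; _→-dec_; _⊎-dec_)
open import Relation.Unary using (Decidable)

-- The field F₄ and words over it

infixl 6 _+₄_ _⊕_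
infix 7 ω·_
infix 5 _⋈_ _⋈ᵥ_
infix 4 _≟₄_

-- F₄ in coordinates with respect to the basis 1, ω.
F₄ : Set
F₄ = Bool × Bool

0₄ : F₄
0₄ = false , false

_+₄_ : F₄ → F₄ → F₄
(a , b) +₄ (c , d) = a xor c , b xor d

-- (a + b ω) ω = b + (a + b) ω, as ω² = 1 + ω.
ω·_ : F₄ → F₄
ω· (a , b) = b , a xor b

-- x ⋈ y = ω² x + ω y
_⋈_ : F₄ → F₄ → F₄
x ⋈ y = x +₄ ω· (x +₄ y)

_≟₄_ : DecidableEquality F₄
_≟₄_ = ≡-dec Bool._≟_ Bool._≟_

∀-Bool? : {P : Bool → Set} → Decidable P → Dec (∀ b → P b)
∀-Bool? P? = map′ (λ (t , f) → λ { true → t ; false → f }) (λ h → h true , h false) (P? true ×-dec P? false)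

∀-F₄? : {P : F₄ → Set} → Decidable P → Dec (∀ x → P x)
∀-F₄? P? = map′ uncurry curry (∀-Bool? λ a → ∀-Bool? λ b → P? (a , b))

+₄-assoc : ∀ x y z → x +₄ y +₄ z ≡ x +₄ (y +₄ z)
+₄-assoc (a , b) (c , d) (e , f) = cong₂ _,_ (xor-assoc a c e) (xor-assoc b d f)

+₄-comm : ∀ x y → x +₄ y ≡ y +₄ x
+₄-comm (a , b) (c , d) = cong₂ _,_ (xor-comm a c) (xor-comm b d)

+₄-identityˡ : ∀ x → 0₄ +₄ x ≡ x
+₄-identityˡ _ = refl

+₄-identityʳ : ∀ x → x +₄ 0₄ ≡ x
+₄-identityʳ (a , b) = cong₂ _,_ (xor-identityʳ a) (xor-identityʳ b)

+₄-self : ∀ x → x +₄ x ≡ 0₄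
+₄-self (a , b) = cong₂ _,_ (xor-same a) (xor-same b)

+₄-cancelˡ : ∀ x y z → x +₄ y ≡ x +₄ z → y ≡ z
+₄-cancelˡ = from-yes (∀-F₄? λ x → ∀-F₄? λ y → ∀-F₄? λ z → (x +₄ y ≟₄ x +₄ z) →-dec (y ≟₄ z))

⋈-translate : ∀ x y r → (x +₄ r) ⋈ (y +₄ r) ≡ (x ⋈ y) +₄ r
⋈-translate = from-yes (∀-F₄? λ x → ∀-F₄? λ y → ∀-F₄? λ r → (x +₄ r) ⋈ (y +₄ r) ≟₄ (x ⋈ y) +₄ r)

⋈-injectiveˡ : ∀ x y z → x ⋈ z ≡ y ⋈ z → x ≡ y
⋈-injectiveˡ = from-yes (∀-F₄? λ x → ∀-F₄? λ y → ∀-F₄? λ z → (x ⋈ z ≟₄ y ⋈ z) →-dec (x ≟₄ y))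

⋈-injectiveʳ : ∀ x y z → x ⋈ y ≡ x ⋈ z → y ≡ z
⋈-injectiveʳ = from-yes (∀-F₄? λ x → ∀-F₄? λ y → ∀-F₄? λ z → (x ⋈ y ≟₄ x ⋈ z) →-dec (y ≟₄ z))

Word : ℕ → Set
Word m = Vec F₄ m

_⊕_ : ∀ {m} → Word m → Word m → Word m
_⊕_ = zipWith _+₄_

_⋈ᵥ_ : ∀ {m} → Word m → Word m → Word m
_⋈ᵥ_ = zipWith _⋈_

0ᵥ : ∀ {m} → Word m
0ᵥ = replicate _ 0₄

⊕-assoc : ∀ {m} (x y z : Word m) → x ⊕ y ⊕ z ≡ x ⊕ (y ⊕ z)
⊕-assoc = zipWith-assoc +₄-assoc

⊕-comm : ∀ {m} (x y : Word m) → x ⊕ y ≡ y ⊕ x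
⊕-comm = zipWith-comm +₄-comm

⊕-identityˡ : ∀ {m} (x : Word m) → 0ᵥ ⊕ x ≡ x
⊕-identityˡ = zipWith-identityˡ +₄-identityˡ

⊕-self : ∀ {m} (x : Word m) → x ⊕ x ≡ 0ᵥ
⊕-self [] = refl
⊕-self (x ∷ xs) = cong₂ _∷_ (+₄-self x) (⊕-self xs)

⊕-self-cancelʳ : ∀ {m} (x y : Word m) → x ⊕ y ⊕ y ≡ x
⊕-self-cancelʳ x y = begin
  x ⊕ y ⊕ y    ≡⟨ ⊕-assoc x y y ⟩
  x ⊕ (y ⊕ y)  ≡⟨ cong (x ⊕_) (⊕-self y) ⟩
  x ⊕ 0ᵥ       ≡⟨ zipWith-identityʳ +₄-identityʳ x ⟩
  x            ∎
  where open ≡-Reasoning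

⊕-self-cancelˡ : ∀ {m} (x y : Word m) → x ⊕ (x ⊕ y) ≡ y
⊕-self-cancelˡ x y = begin
  x ⊕ (x ⊕ y)  ≡⟨ ⊕-assoc x x y ⟨
  x ⊕ x ⊕ y    ≡⟨ cong (_⊕ y) (⊕-self x) ⟩
  0ᵥ ⊕ y       ≡⟨ ⊕-identityˡ y ⟩
  y            ∎
  where open ≡-Reasoning

⊕-cancelʳ : ∀ {m} {x y : Word m} r → x ⊕ r ≡ y ⊕ r → x ≡ y
⊕-cancelʳ {x = x} {y} r eq = trans (sym (⊕-self-cancelʳ x r)) (trans (cong (_⊕ r) eq) (⊕-self-cancelʳ y r))

⊕-commutativeSemigroup : ℕ → CommutativeSemigroup _ _
⊕-commutativeSemigroup m = record
  { Carrier = Word m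
  ; _≈_ = _≡_
  ; _∙_ = _⊕_
  ; isCommutativeSemigroup = record
    { isSemigroup = record { isMagma = isMagma _⊕_ ; assoc = ⊕-assoc }
    ; comm = ⊕-comm
    }
  }
  where open import Relation.Binary.PropositionalEquality.Algebra using (isMagma)

module ⊕-Rearrange {m} = CommutativeSemigroupProperties (⊕-commutativeSemigroup m)

⋈ᵥ-translate : ∀ {m} (x y r : Word m) → (x ⊕ r) ⋈ᵥ (y ⊕ r) ≡ (x ⋈ᵥ y) ⊕ r
⋈ᵥ-translate [] [] [] = refl
⋈ᵥ-translate (x ∷ xs) (y ∷ ys) (r ∷ rs) = cong₂ _∷_ (⋈-translate x y r) (⋈ᵥ-translate xs ys rs)

⋈ᵥ-injectiveˡ : ∀ {m} (x y z : Word m) → x ⋈ᵥ z ≡ y ⋈ᵥ z → x ≡ y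
⋈ᵥ-injectiveˡ [] [] [] _ = refl
⋈ᵥ-injectiveˡ (x ∷ xs) (y ∷ ys) (z ∷ zs) eq with ∷-injective eq
... | head≡ , tail≡ = cong₂ _∷_ (⋈-injectiveˡ x y z head≡) (⋈ᵥ-injectiveˡ xs ys zs tail≡)

⋈ᵥ-injectiveʳ : ∀ {m} (x y z : Word m) → x ⋈ᵥ y ≡ x ⋈ᵥ z → y ≡ z
⋈ᵥ-injectiveʳ [] [] [] _ = refl
⋈ᵥ-injectiveʳ (x ∷ xs) (y ∷ ys) (z ∷ zs) eq with ∷-injective eq
... | head≡ , tail≡ = cong₂ _∷_ (⋈-injectiveʳ x y z head≡) (⋈ᵥ-injectiveʳ xs ys zs tail≡)

-- Vertices, adjacency and subcubes

parity : ∀ {n} → Vec Bool n → Bool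
parity [] = false
parity (x ∷ xs) = x xor parity xs

parity-++ : ∀ {m n} (xs : Vec Bool m) (ys : Vec Bool n) → parity (xs ++ ys) ≡ parity xs xor parity ys
parity-++ [] ys = refl
parity-++ (x ∷ xs) ys = trans (cong (x xor_) (parity-++ xs ys)) (sym (xor-assoc x (parity xs) (parity ys)))

data Adj : ∀ {n} → Vec Bool n → Vec Bool n → Set where
  here  : ∀ {n b} {xs : Vec Bool n} → Adj (b ∷ xs) (not b ∷ xs)
  there : ∀ {n b} {xs ys : Vec Bool n} → Adj xs ys → Adj (b ∷ xs) (b ∷ ys)

Adj-parity : ∀ {n} {u u' : Vec Bool n} → Adj u u' → parity u' ≡ not (parity u)
Adj-parity (here {b = b} {xs}) = sym (not-distribˡ-xor b (parity xs))
Adj-parity (there {b = b} {xs} adj) = trans (cong (b xor_) (Adj-parity adj)) (sym (not-distribʳ-xor b (parity xs)))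

Adj-sym : ∀ {n} {u u' : Vec Bool n} → Adj u u' → Adj u' u
Adj-sym (here {b = b} {xs}) = subst (λ b′ → Adj (not b ∷ xs) (b′ ∷ xs)) (not-involutive b) here
Adj-sym (there adj) = there (Adj-sym adj)

Adj-++ˡ : ∀ {m n} {xs xs' : Vec Bool m} (ys : Vec Bool n) → Adj xs xs' → Adj (xs ++ ys) (xs' ++ ys)
Adj-++ˡ ys here = here
Adj-++ˡ ys (there adj) = there (Adj-++ˡ ys adj)

Adj-++ʳ : ∀ {m n} (xs : Vec Bool m) {ys ys' : Vec Bool n} → Adj ys ys' → Adj (xs ++ ys) (xs ++ ys')
Adj-++ʳ [] adj = adj
Adj-++ʳ (x ∷ xs) adj = there (Adj-++ʳ xs adj)

Adj-++⁻ : ∀ {m n} (xs : Vec Bool m) (ys : Vec Bool n) {w} → Adj (xs ++ ys) w →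
  (∃ λ xs' → Adj xs xs' × w ≡ xs' ++ ys) ⊎ (∃ λ ys' → Adj ys ys' × w ≡ xs ++ ys')
Adj-++⁻ [] ys adj = inj₂ (_ , adj , refl)
Adj-++⁻ (x ∷ xs) ys here = inj₁ (_ , here , refl)
Adj-++⁻ (x ∷ xs) ys (there adj) with Adj-++⁻ xs ys adj
... | inj₁ (xs' , adj' , refl) = inj₁ (x ∷ xs' , there adj' , refl)
... | inj₂ (ys' , adj' , refl) = inj₂ (ys' , adj' , refl)

infix 4 _∈ᶜ_

data _∈ᶜ_ : ∀ {n} → Vec Bool n → Subcube n → Set where
  []    : [] ∈ᶜ []
  free  : ∀ {n x u} {S : Subcube n} → u ∈ᶜ S → x ∷ u ∈ᶜ nothing ∷ S
  fixed : ∀ {n b u} {S : Subcube n} → u ∈ᶜ S → b ∷ u ∈ᶜ just b ∷ S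

∈ᶜ⇒∈ₛ : ∀ {n} {u : Vec Bool n} {S : Subcube n} → u ∈ᶜ S → u ∈ₛ S
∈ᶜ⇒∈ₛ (free u∈S) (suc i) b eq = ∈ᶜ⇒∈ₛ u∈S i b eq
∈ᶜ⇒∈ₛ (fixed u∈S) zero b refl = refl
∈ᶜ⇒∈ₛ (fixed u∈S) (suc i) b eq = ∈ᶜ⇒∈ₛ u∈S i b eq

∈ᶜ-++ : ∀ {m n} {u : Vec Bool m} {v : Vec Bool n} {S T} → u ∈ᶜ S → v ∈ᶜ T → u ++ v ∈ᶜ S ++ T
∈ᶜ-++ [] v∈T = v∈T
∈ᶜ-++ (free u∈S) v∈T = free (∈ᶜ-++ u∈S v∈T)
∈ᶜ-++ (fixed u∈S) v∈T = fixed (∈ᶜ-++ u∈S v∈T)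

dim-++ : ∀ {m n} (S : Subcube m) (T : Subcube n) → dim (S ++ T) ≡ dim S + dim T
dim-++ [] T = refl
dim-++ (nothing ∷ S) T = cong suc (dim-++ S T)
dim-++ (just _ ∷ S) T = dim-++ S T

dim≤ : ∀ {n} (S : Subcube n) → dim S ≤ n
dim≤ [] = z≤n
dim≤ (nothing ∷ S) = s≤s (dim≤ S)
dim≤ (just _ ∷ S) = m≤n⇒m≤1+n (dim≤ S)

some-vertex : ∀ {n} (S : Subcube n) → ∃ (_∈ᶜ S)
some-vertex [] = [] , []
some-vertex (nothing ∷ S) = let u , u∈S = some-vertex S in false ∷ u , free u∈S
some-vertex (just b ∷ S) = let u , u∈S = some-vertex S in b ∷ u , fixed u∈S

free-neighbour : ∀ {n} {S : Subcube n} {u} → 0 < dim S → u ∈ᶜ S → ∃ λ u' → u' ∈ᶜ S × Adj u u'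
free-neighbour _ (free {x = x} u∈S) = not x ∷ _ , free u∈S , here
free-neighbour pos (fixed u∈S) =
  let u' , u'∈S , adj = free-neighbour pos u∈S in _ , fixed u'∈S , there adj

Point : ∀ {n} → Subcube n → Bool → Set
Point S p = ∃ λ u → u ∈ᶜ S × parity u ≡ p

point-of-parity : ∀ {n} (S : Subcube n) → 0 < dim S → ∀ p → Point S p
point-of-parity S pos p with some-vertex S
... | u , u∈S with parity u Bool.≟ p
...   | yes eq = u , u∈S , eq
...   | no neq = let u' , u'∈S , adj = free-neighbour pos u∈S in
                 u' , u'∈S , trans (Adj-parity adj) (sym (¬-not (λ p≡ → neq (sym p≡))))

edge-of-parity : ∀ {n} (S : Subcube n) → 0 < dim S → ∀ p →
  ∃₂ λ u u' → u ∈ᶜ S × u' ∈ᶜ S × Adj u u' × parity u ≡ p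
edge-of-parity S pos p =
  let u , u∈S , u≡p = point-of-parity S pos p
      u' , u'∈S , adj = free-neighbour pos u∈S
  in u , u' , u∈S , u'∈S , adj , u≡p

-- Three blocks

data Block : Set where
  b₁ b₂ b₃ : Block

∀-Block? : {P : Block → Set} → Decidable P → Dec (∀ j → P j)
∀-Block? P? = map′ (λ (p₁ , p₂ , p₃) → λ { b₁ → p₁ ; b₂ → p₂ ; b₃ → p₃ }) (λ h → h b₁ , h b₂ , h b₃)
  (P? b₁ ×-dec P? b₂ ×-dec P? b₃)

next : Block → Block
next b₁ = b₂
next b₂ = b₃
next b₃ = b₁

triple : {A : Set} → A → A → A → Block → A
triple a b c b₁ = a
triple a b c b₂ = b
triple a b c b₃ = c

update : {A : Set} → (Block → A) → Block → A → Block → A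
update T b₁ w b₁ = w
update T b₁ w b₂ = T b₂
update T b₁ w b₃ = T b₃
update T b₂ w b₁ = T b₁
update T b₂ w b₂ = w
update T b₂ w b₃ = T b₃
update T b₃ w b₁ = T b₁
update T b₃ w b₂ = T b₂
update T b₃ w b₃ = w

update-preserves : ∀ {A : Set} (P : Block → A → Set) {T : Block → A} {e w} →
  (∀ j → P j (T j)) → P e w → ∀ j → P j (update T e w j)
update-preserves P {e = b₁} h h₁ b₁ = h₁
update-preserves P {e = b₁} h h₁ b₂ = h b₂
update-preserves P {e = b₁} h h₁ b₃ = h b₃
update-preserves P {e = b₂} h h₂ b₁ = h b₁
update-preserves P {e = b₂} h h₂ b₂ = h₂
update-preserves P {e = b₂} h h₂ b₃ = h b₃
update-preserves P {e = b₃} h h₃ b₁ = h b₁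
update-preserves P {e = b₃} h h₃ b₂ = h b₂
update-preserves P {e = b₃} h h₃ b₃ = h₃

open CommutativeSemigroupProperties +-commutativeSemigroup
  using (x∙yz≈y∙zx; x∙yz≈z∙xy; x∙yz≈x∙zy; x∙yz≈y∙xz; x∙yz≈z∙yx)

data Rest : Block → Block → Block → Set where
  forward  : ∀ {z} → Rest z (next z) (next (next z))
  backward : ∀ {z} → Rest z (next (next z)) (next z)

Rest-cover : ∀ {z e o} → Rest z e o → ∀ j → j ≡ z ⊎ j ≡ e ⊎ j ≡ o
Rest-cover {b₁} forward b₁ = inj₁ refl
Rest-cover {b₁} forward b₂ = inj₂ (inj₁ refl)
Rest-cover {b₁} forward b₃ = inj₂ (inj₂ refl)
Rest-cover {b₂} forward b₁ = inj₂ (inj₂ refl)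
Rest-cover {b₂} forward b₂ = inj₁ refl
Rest-cover {b₂} forward b₃ = inj₂ (inj₁ refl)
Rest-cover {b₃} forward b₁ = inj₂ (inj₁ refl)
Rest-cover {b₃} forward b₂ = inj₂ (inj₂ refl)
Rest-cover {b₃} forward b₃ = inj₁ refl
Rest-cover {b₁} backward b₁ = inj₁ refl
Rest-cover {b₁} backward b₂ = inj₂ (inj₂ refl)
Rest-cover {b₁} backward b₃ = inj₂ (inj₁ refl)
Rest-cover {b₂} backward b₁ = inj₂ (inj₁ refl)
Rest-cover {b₂} backward b₂ = inj₁ refl
Rest-cover {b₂} backward b₃ = inj₂ (inj₂ refl)
Rest-cover {b₃} backward b₁ = inj₂ (inj₂ refl)
Rest-cover {b₃} backward b₂ = inj₂ (inj₁ refl)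
Rest-cover {b₃} backward b₃ = inj₁ refl

Rest-sum : ∀ {z e o} → Rest z e o → (f : Block → ℕ) → f b₁ + (f b₂ + f b₃) ≡ f z + (f e + f o)
Rest-sum {b₁} forward  f = refl
Rest-sum {b₂} forward  f = x∙yz≈y∙zx (f b₁) (f b₂) (f b₃)
Rest-sum {b₃} forward  f = x∙yz≈z∙xy (f b₁) (f b₂) (f b₃)
Rest-sum {b₁} backward f = x∙yz≈x∙zy (f b₁) (f b₂) (f b₃)
Rest-sum {b₂} backward f = x∙yz≈y∙xz (f b₁) (f b₂) (f b₃)
Rest-sum {b₃} backward f = x∙yz≈z∙yx (f b₁) (f b₂) (f b₃)

-- The digit q b₁ + q b₂ ω + q b₃ ω² of a parity pattern of the three blocks.
digit : (Block → Bool) → F₄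
digit q = q b₁ xor q b₃ , q b₂ xor q b₃

blockDigit : Block → F₄
blockDigit b₁ = true , false
blockDigit b₂ = false , true
blockDigit b₃ = true , true

blockDigit-injective : ∀ {e e'} → blockDigit e ≡ blockDigit e' → e ≡ e'
blockDigit-injective {b₁} {b₁} _ = refl
blockDigit-injective {b₂} {b₂} _ = refl
blockDigit-injective {b₃} {b₃} _ = refl
blockDigit-injective {b₁} {b₂} ()
blockDigit-injective {b₁} {b₃} ()
blockDigit-injective {b₂} {b₁} ()
blockDigit-injective {b₂} {b₃} ()
blockDigit-injective {b₃} {b₁} ()
blockDigit-injective {b₃} {b₂} ()

digit-flip : ∀ e a b c → digit (update (triple a b c) e (not (triple a b c e))) ≡ digit (triple a b c) +₄ blockDigit e
digit-flip = from-yes (∀-Block? λ e → ∀-Bool? λ a → ∀-Bool? λ b → ∀-Bool? λ c →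
  digit (update (triple a b c) e (not (triple a b c e))) ≟₄ digit (triple a b c) +₄ blockDigit e)

xor₃ : (Block → Bool) → Bool
xor₃ q = q b₁ xor (q b₂ xor q b₃)

parities : Bool → F₄ → Block → Bool
parities p (k₁ , k₂) = triple (k₁ xor c) (k₂ xor c) c
  where c = p xor (k₁ xor k₂)

xor₃-parities : ∀ p κ → xor₃ (parities p κ) ≡ p
xor₃-parities = from-yes (∀-Bool? λ p → ∀-F₄? λ κ → xor₃ (parities p κ) Bool.≟ p)

digit-parities : ∀ p κ → digit (parities p κ) ≡ κ
digit-parities = from-yes (∀-Bool? λ p → ∀-F₄? λ κ → digit (parities p κ) ≟₄ κ)

-- The block parities q for which an edge inside block e, starting at a vertex with block parities q,
-- has first letter κ.
edgeParities : Block → Bool → F₄ → Block → Bool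
edgeParities e p κ = parities p (κ +₄ ω· blockDigit e)

digit-edgeParities : ∀ e p κ → digit (edgeParities e p κ) ⋈ (digit (edgeParities e p κ) +₄ blockDigit e) ≡ κ
digit-edgeParities = from-yes (∀-Block? λ e → ∀-Bool? λ p → ∀-F₄? λ κ →
  digit (edgeParities e p κ) ⋈ (digit (edgeParities e p κ) +₄ blockDigit e) ≟₄ κ)

-- Whatever the parity b of block z, one of the two other blocks can carry the edge.
edgeBlock : ∀ z p κ b → ∃₂ λ e o → Rest z e o × edgeParities e p κ z ≡ b
edgeBlock z p κ b = [ (λ eq → _ , _ , forward , eq) , (λ eq → _ , _ , backward , eq) ]′ (either z p κ b)
  where
  either : ∀ z p κ b → edgeParities (next z) p κ z ≡ b ⊎ edgeParities (next (next z)) p κ z ≡ b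
  either = from-yes (∀-Block? λ z → ∀-Bool? λ p → ∀-F₄? λ κ → ∀-Bool? λ b →
    edgeParities (next z) p κ z Bool.≟ b ⊎-dec edgeParities (next (next z)) p κ z Bool.≟ b)

join : ∀ {A : Set} {k} → (Block → Vec A k) → Vec A (3 * k)
join T = T b₁ ++ (T b₂ ++ (T b₃ ++ []))

data SplitAt {A : Set} (m : ℕ) {n : ℕ} : Vec A (m + n) → Set where
  split : (xs : Vec A m) (ys : Vec A n) → SplitAt m (xs ++ ys)

splitAt′ : ∀ {A : Set} m {n} (xs : Vec A (m + n)) → SplitAt m xs
splitAt′ zero xs = split [] xs
splitAt′ (suc m) (x ∷ xs) with splitAt′ m xs
... | split ys zs = split (x ∷ ys) zs

splitAt′-++ : ∀ {A : Set} {m n} (xs : Vec A m) (ys : Vec A n) → splitAt′ m (xs ++ ys) ≡ split xs ys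
splitAt′-++ [] ys = refl
splitAt′-++ (x ∷ xs) ys rewrite splitAt′-++ xs ys = refl

data Thirds {A : Set} (k : ℕ) : Vec A (3 * k) → Set where
  thirds : (a b c : Vec A k) → Thirds k (join (triple a b c))

thirds′ : ∀ {A : Set} k (xs : Vec A (3 * k)) → Thirds k xs
thirds′ k xs with splitAt′ k xs
... | split a r with splitAt′ k r
...   | split b r′ with splitAt′ k r′
...     | split c [] = thirds a b c

thirds′-join : ∀ {A : Set} k (T : Block → Vec A k) → thirds′ k (join T) ≡ thirds (T b₁) (T b₂) (T b₃)
thirds′-join k T
  rewrite splitAt′-++ (T b₁) (T b₂ ++ (T b₃ ++ [])) | splitAt′-++ (T b₂) (T b₃ ++ []) | splitAt′-++ (T b₃) [] = refl

∈ᶜ-join : ∀ {k} {T : Block → Vec Bool k} {S : Block → Subcube k} → (∀ j → T j ∈ᶜ S j) → join T ∈ᶜ join S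
∈ᶜ-join T∈S = ∈ᶜ-++ (T∈S b₁) (∈ᶜ-++ (T∈S b₂) (∈ᶜ-++ (T∈S b₃) []))

dim-join : ∀ {k} (S : Block → Subcube k) → dim (join S) ≡ dim (S b₁) + (dim (S b₂) + dim (S b₃))
dim-join S rewrite dim-++ (S b₁) (S b₂ ++ (S b₃ ++ [])) | dim-++ (S b₂) (S b₃ ++ []) | dim-++ (S b₃) []
  | +-identityʳ (dim (S b₃)) = refl

parity-join : ∀ {k} (T : Block → Vec Bool k) → parity (join T) ≡ xor₃ (parity ∘ T)
parity-join T rewrite parity-++ (T b₁) (T b₂ ++ (T b₃ ++ [])) | parity-++ (T b₂) (T b₃ ++ []) | parity-++ (T b₃) []
  | xor-identityʳ (parity (T b₃)) = refl

Adj-join : ∀ {k} (T : Block → Vec Bool k) e {w w'} → Adj w w' → Adj (join (update T e w)) (join (update T e w'))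
Adj-join T b₁ adj = Adj-++ˡ _ adj
Adj-join T b₂ adj = Adj-++ʳ (T b₁) (Adj-++ˡ _ adj)
Adj-join T b₃ adj = Adj-++ʳ (T b₁) (Adj-++ʳ (T b₂) (Adj-++ˡ [] adj))

Adj-join⁻ : ∀ {k} (T : Block → Vec Bool k) {a} → Adj (join T) a →
  ∃₂ λ e w → Adj (T e) w × a ≡ join (update T e w)
Adj-join⁻ T adj with Adj-++⁻ (T b₁) (T b₂ ++ (T b₃ ++ [])) adj
... | inj₁ (w , adj₁ , refl) = b₁ , w , adj₁ , refl
... | inj₂ (_ , adj₁ , refl) with Adj-++⁻ (T b₂) (T b₃ ++ []) adj₁
...   | inj₁ (w , adj₂ , refl) = b₂ , w , adj₂ , refl
...   | inj₂ (_ , adj₂ , refl) with Adj-++⁻ (T b₃) [] adj₂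
...     | inj₁ (w , adj₃ , refl) = b₃ , w , adj₃ , refl
...     | inj₂ (_ , () , _)

digit-cong : ∀ {q q'} → (∀ j → q j ≡ q' j) → digit q ≡ digit q'
digit-cong {q} eq rewrite eq b₁ | eq b₂ | eq b₃ = refl

xor₃-cong : ∀ {q q'} → (∀ j → q j ≡ q' j) → xor₃ q ≡ xor₃ q'
xor₃-cong {q} eq rewrite eq b₁ | eq b₂ | eq b₃ = refl

digit-update : ∀ {k} e (T : Block → Vec Bool k) w w' → parity w' ≡ not (parity w) →
  digit (parity ∘ update T e w') ≡ digit (parity ∘ update T e w) +₄ blockDigit e
digit-update b₁ T w w' eq rewrite eq = digit-flip b₁ (parity w) (parity (T b₂)) (parity (T b₃))
digit-update b₂ T w w' eq rewrite eq = digit-flip b₂ (parity (T b₁)) (parity w) (parity (T b₃))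
digit-update b₃ T w w' eq rewrite eq = digit-flip b₃ (parity (T b₁)) (parity (T b₂)) (parity w)

digit-update-self : ∀ {k} e (T : Block → Vec Bool k) → digit (parity ∘ update T e (T e)) ≡ digit (parity ∘ T)
digit-update-self b₁ T = refl
digit-update-self b₂ T = refl
digit-update-self b₃ T = refl

-- The labelling

Σ₃ : ∀ {m} → (Block → Word m) → Word m
Σ₃ g = g b₁ ⊕ (g b₂ ⊕ g b₃)

others : ∀ {m} → Block → (Block → Word m) → Word m
others e g = g (next e) ⊕ g (next (next e))

Σ₃-update : ∀ {A : Set} {m} (f : A → Word m) e T w → Σ₃ (f ∘ update T e w) ≡ f w ⊕ others e (f ∘ T)
Σ₃-update f b₁ T w = refl
Σ₃-update f b₂ T w = ⊕-Rearrange.x∙yz≈y∙zx (f (T b₁)) (f w) (f (T b₃))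
Σ₃-update f b₃ T w = ⊕-Rearrange.x∙yz≈z∙xy (f (T b₁)) (f (T b₂)) (f w)

others-update-rest : ∀ {A : Set} {m} (f : A → Word m) {z e o} → Rest z e o → ∀ T v →
  others e (f ∘ update T o v) ≡ f v ⊕ f (T z)
others-update-rest f {b₁} forward T v = refl
others-update-rest f {b₂} forward T v = refl
others-update-rest f {b₃} forward T v = refl
others-update-rest f {b₁} backward T v = ⊕-comm (f (T b₁)) (f v)
others-update-rest f {b₂} backward T v = ⊕-comm (f (T b₂)) (f v)
others-update-rest f {b₃} backward T v = ⊕-comm (f (T b₃)) (f v)

L : ∀ m → Vec Bool (3 ^ m) → Word m
L zero _ = []
L (suc m) x with thirds′ (3 ^ m) x
... | thirds a b c = digit (parity ∘ triple a b c) ∷ Σ₃ (L m ∘ triple a b c)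

L-join : ∀ m (T : Block → Vec Bool (3 ^ m)) → L (suc m) (join T) ≡ digit (parity ∘ T) ∷ Σ₃ (L m ∘ T)
L-join m T rewrite thirds′-join (3 ^ m) T = refl

-- Large subcubes contain vertices and edges of every label

pigeonhole : ∀ {k} (f : Block → ℕ) → k < f b₁ + (f b₂ + f b₃) → ∃ λ e → k < 3 * f e
pigeonhole {k} f k<Σ with k <? 3 * f b₁ | k <? 3 * f b₂ | k <? 3 * f b₃
... | yes k<₁ | _      | _       = b₁ , k<₁
... | no _    | yes k<₂ | _      = b₂ , k<₂
... | no _    | no _   | yes k<₃ = b₃ , k<₃
... | no ≮₁   | no ≮₂  | no ≮₃   = contradiction (*-monoʳ-< 3 k<Σ) (≤⇒≯ 3Σ≤3k)
  where
  open ≤-Reasoning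
  3Σ≤3k : 3 * (f b₁ + (f b₂ + f b₃)) ≤ 3 * k
  3Σ≤3k = begin
    3 * (f b₁ + (f b₂ + f b₃))               ≡⟨ *-distribˡ-+ 3 (f b₁) _ ⟩
    3 * f b₁ + 3 * (f b₂ + f b₃)             ≡⟨ cong (3 * f b₁ +_) (*-distribˡ-+ 3 (f b₂) (f b₃)) ⟩
    3 * f b₁ + (3 * f b₂ + 3 * f b₃)         ≤⟨ +-mono-≤ (≮⇒≥ ≮₁) (+-mono-≤ (≮⇒≥ ≮₂) (≮⇒≥ ≮₃)) ⟩
    k + (k + k)                              ≡⟨ cong (λ x → k + (k + x)) (+-identityʳ k) ⟨
    3 * k                                    ∎

positive-summand : ∀ {k a b} → k < a + b → b ≤ k → 0 < a
positive-summand {a = zero} k<b b≤k = contradiction k<b (≤⇒≯ b≤k)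
positive-summand {a = suc _} _ _ = z<s

large-summand : ∀ {k a b} → k < a + b → 3 * a ≤ k → 2 * k < 3 * b
large-summand {k} {a} {b} k<a+b 3a≤k = +-cancelˡ-< k (2 * k) (3 * b) (begin-strict
  3 * k            <⟨ *-monoʳ-< 3 k<a+b ⟩
  3 * (a + b)      ≡⟨ *-distribˡ-+ 3 a b ⟩
  3 * a + 3 * b    ≤⟨ +-monoˡ-≤ (3 * b) 3a≤k ⟩
  k + 3 * b        ∎)
  where open ≤-Reasoning

all-positive : ∀ {k} (f : Block → ℕ) → 2 * k < f b₁ + (f b₂ + f b₃) → (∀ j → f j ≤ k) → ∀ j → 0 < f j
all-positive {k} f 2k<Σ f≤k j = positive-summand (subst (2 * k <_) (Rest-sum (forward {j}) f) 2k<Σ)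
  (+-mono-≤ (f≤k (next j)) (≤-trans (f≤k (next (next j))) (m≤m+n k 0)))

zero-or-positive : ∀ (f : Block → ℕ) → (∃ λ z → f z ≡ 0) ⊎ (∀ j → 0 < f j)
zero-or-positive f with f b₁ in eq₁ | f b₂ in eq₂ | f b₃ in eq₃
... | zero  | _     | _     = inj₁ (b₁ , eq₁)
... | suc _ | zero  | _     = inj₁ (b₂ , eq₂)
... | suc _ | suc _ | zero  = inj₁ (b₃ , eq₃)
... | suc _ | suc _ | suc _ = inj₂ λ { b₁ → positive eq₁ ; b₂ → positive eq₂ ; b₃ → positive eq₃ }
  where
  positive : ∀ {n m} → n ≡ suc m → 0 < n
  positive refl = z<s

record LabelledVertex (m : ℕ) (S : Subcube (3 ^ m)) (p : Bool) (g : Word m) : Set where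
  constructor labelledVertex
  field
    {vertex} : Vec Bool (3 ^ m)
    vertex∈S : vertex ∈ᶜ S
    parity≡  : parity vertex ≡ p
    label≡   : L m vertex ≡ g

record LabelledEdge (m : ℕ) (S : Subcube (3 ^ m)) (p : Bool) (s : Word m) : Set where
  constructor labelledEdge
  field
    {start end} : Vec Bool (3 ^ m)
    start∈S  : start ∈ᶜ S
    end∈S    : end ∈ᶜ S
    adjacent : Adj start end
    parity≡  : parity start ≡ p
    label≡   : L m start ⋈ᵥ L m end ≡ s

open LabelledVertex
open LabelledEdge

EveryVertexLabel EveryEdgeLabel : ℕ → Set
EveryVertexLabel m = ∀ S → 2 * 3 ^ m < 3 * dim S → ∀ p g → LabelledVertex m S p g
EveryEdgeLabel m = ∀ S → 3 ^ m < 3 * dim S → ∀ p s → LabelledEdge m S p s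

Placed : ∀ {k} → (Block → Subcube k) → (Block → Bool) → (Block → Vec Bool k) → Set
Placed S q T = ∀ j → T j ∈ᶜ S j × parity (T j) ≡ q j

placed-update : ∀ {k} {S : Block → Subcube k} {q T e w} → Placed S q T → w ∈ᶜ S e → parity w ≡ q e →
  Placed S q (update T e w)
placed-update {S = S} {q} placed w∈S w≡ = update-preserves (λ j x → x ∈ᶜ S j × parity x ≡ q j) placed (w∈S , w≡)

place-vertices : ∀ {k} {S : Block → Subcube k} → (∀ j → 0 < dim (S j)) → ∀ q → ∃ (Placed S q)
place-vertices {S = S} pos q = (λ j → proj₁ (P j)) , (λ j → proj₂ (P j))
  where P = λ j → point-of-parity (S j) (pos j) (q j)

module _ {m} {S : Block → Subcube (3 ^ m)} {p : Bool} {κ : F₄} where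

  lift-vertex : ∀ t T {g} → Placed S (parities p κ) T →
    LabelledVertex m (S t) (parities p κ t) (g ⊕ others t (L m ∘ T)) → LabelledVertex (suc m) (join S) p (κ ∷ g)
  lift-vertex t T {g} placed v = labelledVertex (∈ᶜ-join (proj₁ ∘ placed′)) parity≡′ label≡′
    where
    T′ = update T t (vertex v)
    r = others t (L m ∘ T)
    placed′ = placed-update placed (vertex∈S v) (parity≡ v)
    parity≡′ : parity (join T′) ≡ p
    parity≡′ = trans (parity-join T′) (trans (xor₃-cong (proj₂ ∘ placed′)) (xor₃-parities p κ))
    label≡′ : L (suc m) (join T′) ≡ κ ∷ g
    label≡′ = begin
      L (suc m) (join T′)
        ≡⟨ L-join m T′ ⟩
      digit (parity ∘ T′) ∷ Σ₃ (L m ∘ T′)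
        ≡⟨ cong₂ _∷_ (digit-cong (proj₂ ∘ placed′)) (Σ₃-update (L m) t T (vertex v)) ⟩
      digit (parities p κ) ∷ (L m (vertex v) ⊕ r)
        ≡⟨ cong₂ _∷_ (digit-parities p κ) (cong (_⊕ r) (label≡ v)) ⟩
      κ ∷ (g ⊕ r ⊕ r)
        ≡⟨ cong (κ ∷_) (⊕-self-cancelʳ g r) ⟩
      κ ∷ g ∎
      where open ≡-Reasoning

  lift-edge : ∀ e T {s} → Placed S (edgeParities e p κ) T →
    LabelledEdge m (S e) (edgeParities e p κ e) (s ⊕ others e (L m ∘ T)) → LabelledEdge (suc m) (join S) p (κ ∷ s)
  lift-edge e T {s} placed E = labelledEdge (∈ᶜ-join (proj₁ ∘ placed′)) (∈ᶜ-join end∈) (Adj-join T e (adjacent E))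
    parity≡′ (trans (cong₂ _⋈ᵥ_ (L-join m (update T e w)) (L-join m (update T e w'))) (cong₂ _∷_ head≡ tail≡))
    where
    w = start E
    w' = end E
    q = edgeParities e p κ
    r = others e (L m ∘ T)
    placed′ = placed-update placed (start∈S E) (parity≡ E)
    end∈ : ∀ j → update T e w' j ∈ᶜ S j
    end∈ = update-preserves (λ j x → x ∈ᶜ S j) (proj₁ ∘ placed) (end∈S E)
    parity≡′ : parity (join (update T e w)) ≡ p
    parity≡′ = trans (parity-join (update T e w))
      (trans (xor₃-cong (proj₂ ∘ placed′)) (xor₃-parities p (κ +₄ ω· blockDigit e)))
    open ≡-Reasoning
    head≡ : digit (parity ∘ update T e w) ⋈ digit (parity ∘ update T e w') ≡ κ
    head≡ = begin
      digit (parity ∘ update T e w) ⋈ digit (parity ∘ update T e w')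
        ≡⟨ cong (digit (parity ∘ update T e w) ⋈_) (digit-update e T w w' (Adj-parity (adjacent E))) ⟩
      digit (parity ∘ update T e w) ⋈ (digit (parity ∘ update T e w) +₄ blockDigit e)
        ≡⟨ cong (λ d → d ⋈ (d +₄ blockDigit e)) (digit-cong (proj₂ ∘ placed′)) ⟩
      digit q ⋈ (digit q +₄ blockDigit e)
        ≡⟨ digit-edgeParities e p κ ⟩
      κ ∎
    tail≡ : Σ₃ (L m ∘ update T e w) ⋈ᵥ Σ₃ (L m ∘ update T e w') ≡ s
    tail≡ = begin
      Σ₃ (L m ∘ update T e w) ⋈ᵥ Σ₃ (L m ∘ update T e w')
        ≡⟨ cong₂ _⋈ᵥ_ (Σ₃-update (L m) e T w) (Σ₃-update (L m) e T w') ⟩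
      (L m w ⊕ r) ⋈ᵥ (L m w' ⊕ r)
        ≡⟨ ⋈ᵥ-translate (L m w) (L m w') r ⟩
      (L m w ⋈ᵥ L m w') ⊕ r
        ≡⟨ cong (_⊕ r) (label≡ E) ⟩
      s ⊕ r ⊕ r
        ≡⟨ ⊕-self-cancelʳ s r ⟩
      s ∎

  -- The edge lies in block e; block o is used to correct the label.
  edge-label-across-blocks : ∀ {z e o s} → Rest z e o → ∀ T → Placed S (edgeParities e p κ) T → 0 < dim (S e) →
    (∀ p g → LabelledVertex m (S o) p g) → LabelledEdge (suc m) (join S) p (κ ∷ s)
  edge-label-across-blocks {z} {e} {o} {s} rest T placed pos-e surj-o with edge-of-parity (S e) pos-e (edgeParities e p κ e)
  ... | w , w' , w∈S , w'∈S , adj , w≡ = lift-edge e T′ placed′ (labelledEdge w∈S w'∈S adj w≡ label≡′)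
    where
    X = L m w ⋈ᵥ L m w'
    v = surj-o (edgeParities e p κ o) (s ⊕ X ⊕ L m (T z))
    T′ = update T o (vertex v)
    placed′ = placed-update placed (vertex∈S v) (parity≡ v)
    label≡′ : X ≡ s ⊕ others e (L m ∘ T′)
    label≡′ = sym (begin
      s ⊕ others e (L m ∘ T′)          ≡⟨ cong (s ⊕_) (others-update-rest (L m) rest T (vertex v)) ⟩
      s ⊕ (L m (vertex v) ⊕ L m (T z)) ≡⟨ cong (λ x → s ⊕ (x ⊕ L m (T z))) (label≡ v) ⟩
      s ⊕ (s ⊕ X ⊕ L m (T z) ⊕ L m (T z))  ≡⟨ cong (s ⊕_) (⊕-self-cancelʳ (s ⊕ X) (L m (T z))) ⟩
      s ⊕ (s ⊕ X)                      ≡⟨ ⊕-self-cancelˡ s X ⟩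
      X                                ∎)
      where open ≡-Reasoning

  edge-label-point-block : ∀ z {s} → dim (S z) ≡ 0 → 3 ^ m < dim (S b₁) + (dim (S b₂) + dim (S b₃)) →
    EveryEdgeLabel m → EveryVertexLabel m → LabelledEdge (suc m) (join S) p (κ ∷ s)
  edge-label-point-block z {s} Dz≡0 large every-edge every-vertex with some-vertex (S z)
  ... | c , c∈S with edgeBlock z p κ (parity c)
  ...   | e , o , rest , c≡ = choose (3 ^ m <? 3 * D e)
    where
    D = dim ∘ S
    large′ : 3 ^ m < D e + D o
    large′ = subst (λ x → 3 ^ m < x + (D e + D o)) Dz≡0 (subst (3 ^ m <_) (Rest-sum rest D) large)
    pos-e : 0 < D e
    pos-e = positive-summand large′ (dim≤ (S o))
    pos-o : 0 < D o
    pos-o = positive-summand (subst (3 ^ m <_) (+-comm (D e) (D o)) large′) (dim≤ (S e))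
    point : ∀ j → Point (S j) (edgeParities e p κ j)
    point j with Rest-cover rest j
    ... | inj₁ refl = c , c∈S , sym c≡
    ... | inj₂ (inj₁ refl) = point-of-parity (S e) pos-e _
    ... | inj₂ (inj₂ refl) = point-of-parity (S o) pos-o _
    T = λ j → proj₁ (point j)
    placed = λ j → proj₂ (point j)
    choose : Dec (3 ^ m < 3 * D e) → LabelledEdge (suc m) (join S) p (κ ∷ s)
    choose (yes big) = lift-edge e T placed (every-edge (S e) big _ _)
    choose (no small) = edge-label-across-blocks rest T placed pos-e
      (every-vertex (S o) (large-summand {a = D e} large′ (≮⇒≥ small)))

  edge-label-join : ∀ {s} → 3 ^ m < dim (S b₁) + (dim (S b₂) + dim (S b₃)) → EveryEdgeLabel m → EveryVertexLabel m →
    LabelledEdge (suc m) (join S) p (κ ∷ s)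
  edge-label-join large every-edge every-vertex with zero-or-positive (dim ∘ S)
  ... | inj₁ (z , Dz≡0) = edge-label-point-block z Dz≡0 large every-edge every-vertex
  ... | inj₂ pos with pigeonhole (dim ∘ S) large
  ...   | e , big = let T , placed = place-vertices pos (edgeParities e p κ) in lift-edge e T placed (every-edge (S e) big _ _)

  vertex-label-join : ∀ {g} → 2 * 3 ^ m < dim (S b₁) + (dim (S b₂) + dim (S b₃)) → EveryVertexLabel m →
    LabelledVertex (suc m) (join S) p (κ ∷ g)
  vertex-label-join large every-vertex with pigeonhole (dim ∘ S) large
  ... | t , big = let T , placed = place-vertices (all-positive (dim ∘ S) large (dim≤ ∘ S)) (parities p κ) in
                  lift-vertex t T placed (every-vertex (S t) big _ _)

every-vertex-label : ∀ m → EveryVertexLabel m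
every-vertex-label zero (nothing ∷ []) _ p [] = labelledVertex (free {x = p} []) (xor-identityʳ p) refl
every-vertex-label (suc m) S large p (κ ∷ g) with thirds′ (3 ^ m) S
... | thirds S₁ S₂ S₃ = vertex-label-join {S = triple S₁ S₂ S₃} large′ (every-vertex-label m)
  where
  3*2N≡2*3N : 3 * (2 * 3 ^ m) ≡ 2 * 3 ^ suc m
  3*2N≡2*3N = trans (sym (*-assoc 3 2 (3 ^ m))) (*-assoc 2 3 (3 ^ m))
  large′ : 2 * 3 ^ m < dim S₁ + (dim S₂ + dim S₃)
  large′ = subst (2 * 3 ^ m <_) (dim-join (triple S₁ S₂ S₃))
    (*-cancelˡ-< 3 _ _ (subst (_< 3 * dim (join (triple S₁ S₂ S₃))) (sym 3*2N≡2*3N) large))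

every-edge-label : ∀ m → EveryEdgeLabel m
every-edge-label zero (nothing ∷ []) _ p [] = labelledEdge (free {x = p} []) (free []) here (xor-identityʳ p) refl
every-edge-label (suc m) S large p (κ ∷ s) with thirds′ (3 ^ m) S
... | thirds S₁ S₂ S₃ = edge-label-join {S = triple S₁ S₂ S₃} large′ (every-edge-label m) (every-vertex-label m)
  where
  large′ : 3 ^ m < dim S₁ + (dim S₂ + dim S₃)
  large′ = subst (3 ^ m <_) (dim-join (triple S₁ S₂ S₃)) (*-cancelˡ-< 3 _ _ large)

-- Edges and their labels

L-join-neighbour : ∀ m (T : Block → Vec Bool (3 ^ m)) e {w} → Adj (T e) w →
  L (suc m) (join (update T e w)) ≡ (digit (parity ∘ T) +₄ blockDigit e) ∷ (L m w ⊕ others e (L m ∘ T))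
L-join-neighbour m T e {w} adj = trans (L-join m (update T e w)) (cong₂ _∷_
  (trans (digit-update e T (T e) w (Adj-parity adj)) (cong (_+₄ blockDigit e) (digit-update-self e T)))
  (Σ₃-update (L m) e T w))

L-injective-on-neighbours : ∀ m {v a b : Vec Bool (3 ^ m)} → Adj v a → Adj v b → L m a ≡ L m b → a ≡ b
L-injective-on-neighbours zero here here _ = refl
L-injective-on-neighbours zero (there ()) _ _
L-injective-on-neighbours zero here (there ()) _
L-injective-on-neighbours (suc m) {v} adj-a adj-b La≡Lb with thirds′ (3 ^ m) v
... | thirds x y z with Adj-join⁻ (triple x y z) adj-a | Adj-join⁻ (triple x y z) adj-b
...   | e₁ , w₁ , adj₁ , refl | e₂ , w₂ , adj₂ , refl
      with ∷-injective (trans (sym (L-join-neighbour m (triple x y z) e₁ adj₁))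
                              (trans La≡Lb (L-join-neighbour m (triple x y z) e₂ adj₂)))
...     | head≡ , tail≡ with blockDigit-injective {e₁} {e₂} (+₄-cancelˡ (digit (parity ∘ triple x y z)) _ _ head≡)
...       | refl = cong (join ∘ update (triple x y z) e₁)
                     (L-injective-on-neighbours m adj₁ adj₂ (⊕-cancelʳ _ tail≡))

toEdge : ∀ {n} {u u' : Vec Bool n} → Adj u u' → Edge n
toEdge (here {b = false} {xs}) = edge (false ∷ xs) zero refl
toEdge (here {b = true} {xs}) = edge (false ∷ xs) zero refl
toEdge (there {b = b} adj) = edge (b ∷ base (toEdge adj)) (suc (dir (toEdge adj))) (low (toEdge adj))

toEdge-ends : ∀ {n} {u u' : Vec Bool n} (adj : Adj u u') →
  (lowEnd (toEdge adj) ≡ u × highEnd (toEdge adj) ≡ u') ⊎ (lowEnd (toEdge adj) ≡ u' × highEnd (toEdge adj) ≡ u)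
toEdge-ends (here {b = false}) = inj₁ (refl , refl)
toEdge-ends (here {b = true}) = inj₂ (refl , refl)
toEdge-ends (there {b = b} adj) with toEdge-ends adj
... | inj₁ (low≡ , high≡) = inj₁ (cong (b ∷_) low≡ , cong (b ∷_) high≡)
... | inj₂ (low≡ , high≡) = inj₂ (cong (b ∷_) low≡ , cong (b ∷_) high≡)

IsEnd : ∀ {n} → Vec Bool n → Edge n → Set
IsEnd v e = v ≡ lowEnd e ⊎ v ≡ highEnd e

toEdge-isEnd : ∀ {n} {u u' : Vec Bool n} (adj : Adj u u') → IsEnd u (toEdge adj) × IsEnd u' (toEdge adj)
toEdge-isEnd adj with toEdge-ends adj
... | inj₁ (low≡ , high≡) = inj₁ (sym low≡) , inj₂ (sym high≡)
... | inj₂ (low≡ , high≡) = inj₂ (sym high≡) , inj₁ (sym low≡)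

Adj-edge : ∀ {n} (e : Edge n) → Adj (lowEnd e) (highEnd e)
Adj-edge (edge (false ∷ xs) zero refl) = here
Adj-edge (edge (b ∷ xs) (suc i) p) = there (Adj-edge (edge xs i p))

edge-ends-injective : ∀ {n} (e f : Edge n) → lowEnd e ≡ lowEnd f → highEnd e ≡ highEnd f → e ≡ f
edge-ends-injective (edge (false ∷ xs) zero refl) (edge (false ∷ ys) zero refl) low≡ _ =
  cong (λ v → edge (false ∷ v) zero refl) (∷-injectiveʳ low≡)
edge-ends-injective (edge (false ∷ xs) zero refl) (edge (false ∷ ys) (suc j) q) _ ()
edge-ends-injective (edge (false ∷ xs) zero refl) (edge (true ∷ ys) (suc j) q) () _
edge-ends-injective (edge (false ∷ xs) (suc i) p) (edge (false ∷ ys) zero refl) _ ()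
edge-ends-injective (edge (true ∷ xs) (suc i) p) (edge (false ∷ ys) zero refl) () _
edge-ends-injective (edge (x ∷ xs) (suc i) p) (edge (y ∷ ys) (suc j) q) low≡ high≡
  with ∷-injective low≡ | ∷-injectiveʳ high≡
... | refl , low≡′ | high≡′ =
  cong (λ e → edge (x ∷ base e) (suc (dir e)) (low e)) (edge-ends-injective (edge xs i p) (edge ys j q) low≡′ high≡′)

edge-ends-not-swapped : ∀ {n} (e f : Edge n) → lowEnd e ≡ highEnd f → highEnd e ≡ lowEnd f → ⊥
edge-ends-not-swapped (edge (false ∷ xs) zero refl) (edge (false ∷ ys) zero refl) () _
edge-ends-not-swapped (edge (false ∷ xs) zero refl) (edge (false ∷ ys) (suc j) q) _ ()
edge-ends-not-swapped (edge (false ∷ xs) zero refl) (edge (true ∷ ys) (suc j) q) () _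
edge-ends-not-swapped (edge (false ∷ xs) (suc i) p) (edge (false ∷ ys) zero refl) () _
edge-ends-not-swapped (edge (true ∷ xs) (suc i) p) (edge (false ∷ ys) zero refl) _ ()
edge-ends-not-swapped (edge (x ∷ xs) (suc i) p) (edge (y ∷ ys) (suc j) q) low≡high high≡low =
  edge-ends-not-swapped (edge xs i p) (edge ys j q) (∷-injectiveʳ low≡high) (∷-injectiveʳ high≡low)

oddEnd evenEnd : ∀ {n} → Edge n → Vec Bool n
oddEnd e = if parity (lowEnd e) then lowEnd e else highEnd e
evenEnd e = if parity (lowEnd e) then highEnd e else lowEnd e

edgeLabel : ∀ m → Edge (3 ^ m) → Word m
edgeLabel m e = L m (oddEnd e) ⋈ᵥ L m (evenEnd e)

Adj-oddEnd-evenEnd : ∀ {n} (e : Edge n) → Adj (oddEnd e) (evenEnd e)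
Adj-oddEnd-evenEnd e with parity (lowEnd e)
... | true = Adj-edge e
... | false = Adj-sym (Adj-edge e)

parity-oddEnd : ∀ {n} (e : Edge n) → parity (oddEnd e) ≡ true
parity-oddEnd e with parity (lowEnd e) in eq
... | true = eq
... | false = trans (Adj-parity (Adj-edge e)) (cong not eq)

parity-lowEnd : ∀ {n} (e : Edge n) → parity (lowEnd e) ≡ not (parity (highEnd e))
parity-lowEnd e = trans (sym (not-involutive _)) (cong not (sym (Adj-parity (Adj-edge e))))

oddEnd-unique : ∀ {n} {v} (e : Edge n) → IsEnd v e → parity v ≡ true → oddEnd e ≡ v
oddEnd-unique e (inj₁ refl) odd rewrite odd = refl
oddEnd-unique e (inj₂ refl) odd rewrite parity-lowEnd e | odd = refl

evenEnd-unique : ∀ {n} {v} (e : Edge n) → IsEnd v e → parity v ≡ false → evenEnd e ≡ v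
evenEnd-unique e (inj₁ refl) even rewrite even = refl
evenEnd-unique e (inj₂ refl) even rewrite parity-lowEnd e | even = refl

edge-≡ : ∀ {n} {e f : Edge n} → oddEnd e ≡ oddEnd f → evenEnd e ≡ evenEnd f → e ≡ f
edge-≡ {e = e} {f} odd≡ even≡ with parity (lowEnd e) | parity (lowEnd f)
... | true  | true  = edge-ends-injective e f odd≡ even≡
... | false | false = edge-ends-injective e f even≡ odd≡
... | true  | false = ⊥-elim (edge-ends-not-swapped e f odd≡ even≡)
... | false | true  = ⊥-elim (edge-ends-not-swapped f e (sym odd≡) (sym even≡))

shared-end : ∀ {n} {e f : Edge n} → ShareVertex e f → ∃ λ v → IsEnd v e × IsEnd v f
shared-end {e = e} (inj₁ eq) = lowEnd e , inj₁ refl , inj₁ eq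
shared-end {e = e} (inj₂ (inj₁ eq)) = lowEnd e , inj₁ refl , inj₂ eq
shared-end {e = e} (inj₂ (inj₂ (inj₁ eq))) = highEnd e , inj₂ refl , inj₁ eq
shared-end {e = e} (inj₂ (inj₂ (inj₂ eq))) = highEnd e , inj₂ refl , inj₂ eq

-- Edges at a vertex v all have v as their odd end or all as their even end, and ⋈ is injective
-- in each argument, so equal labels force equal other ends.
same-label-sharing : ∀ m (e f : Edge (3 ^ m)) → edgeLabel m e ≡ edgeLabel m f → ShareVertex e f → e ≡ f
same-label-sharing m e f label≡ share with shared-end {e = e} {f} share
... | v , v-e , v-f with parity v in pv
...   | true = edge-≡ (trans odd-e (sym odd-f)) (L-injective-on-neighbours m (neighbour e odd-e) (neighbour f odd-f) L≡)
  where
  odd-e = oddEnd-unique e v-e pv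
  odd-f = oddEnd-unique f v-f pv
  neighbour : ∀ g → oddEnd g ≡ v → Adj v (evenEnd g)
  neighbour g odd-g = subst (λ x → Adj x (evenEnd g)) odd-g (Adj-oddEnd-evenEnd g)
  L≡ : L m (evenEnd e) ≡ L m (evenEnd f)
  L≡ = ⋈ᵥ-injectiveʳ (L m v) _ _
    (subst₂ (λ x y → L m x ⋈ᵥ L m (evenEnd e) ≡ L m y ⋈ᵥ L m (evenEnd f)) odd-e odd-f label≡)
...   | false = edge-≡ (L-injective-on-neighbours m (neighbour e even-e) (neighbour f even-f) L≡) (trans even-e (sym even-f))
  where
  even-e = evenEnd-unique e v-e pv
  even-f = evenEnd-unique f v-f pv
  neighbour : ∀ g → evenEnd g ≡ v → Adj v (oddEnd g)
  neighbour g even-g = subst (λ x → Adj x (oddEnd g)) even-g (Adj-sym (Adj-oddEnd-evenEnd g))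
  L≡ : L m (oddEnd e) ≡ L m (oddEnd f)
  L≡ = ⋈ᵥ-injectiveˡ _ _ (L m v)
    (subst₂ (λ x y → L m (oddEnd e) ⋈ᵥ L m x ≡ L m (oddEnd f) ⋈ᵥ L m y) even-e even-f label≡)

infixl 6 _⊻_

_⊻_ : ∀ {n} → Vec Bool n → Vec Bool n → Vec Bool n
_⊻_ = zipWith _xor_

xor-interchange : ∀ a b c d → (a xor b) xor (c xor d) ≡ (a xor c) xor (b xor d)
xor-interchange = from-yes (∀-Bool? λ a → ∀-Bool? λ b → ∀-Bool? λ c → ∀-Bool? λ d →
  (a xor b) xor (c xor d) Bool.≟ (a xor c) xor (b xor d))

parity-⊻ : ∀ {n} (x c : Vec Bool n) → parity (x ⊻ c) ≡ parity x xor parity c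
parity-⊻ [] [] = refl
parity-⊻ (x ∷ xs) (c ∷ cs) = trans (cong ((x xor c) xor_) (parity-⊻ xs cs)) (xor-interchange x c (parity xs) (parity cs))

⊻-cancelʳ : ∀ {n} (x c : Vec Bool n) → x ⊻ c ⊻ c ≡ x
⊻-cancelʳ [] [] = refl
⊻-cancelʳ (x ∷ xs) (c ∷ cs) = cong₂ _∷_ (trans (xor-assoc x c c) (trans (cong (x xor_) (xor-same c)) (xor-identityʳ x)))
  (⊻-cancelʳ xs cs)

Adj-⊻ : ∀ {n} (c : Vec Bool n) {u u'} → Adj u u' → Adj (u ⊻ c) (u' ⊻ c)
Adj-⊻ (c ∷ cs) (here {b = b} {xs}) = subst (λ x → Adj ((b xor c) ∷ xs ⊻ cs) (x ∷ xs ⊻ cs)) (not-distribˡ-xor b c) here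
Adj-⊻ (c ∷ cs) (there adj) = there (Adj-⊻ cs adj)

join-⊻ : ∀ {k} (X C : Block → Vec Bool k) → join X ⊻ join C ≡ join (λ j → X j ⊻ C j)
join-⊻ X C rewrite zipWith-++ _xor_ (X b₁) (X b₂ ++ (X b₃ ++ [])) (C b₁) (C b₂ ++ (C b₃ ++ []))
  | zipWith-++ _xor_ (X b₂) (X b₃ ++ []) (C b₂) (C b₃ ++ []) | zipWith-++ _xor_ (X b₃) [] (C b₃) [] = refl

digit-xor : ∀ q q' → digit (λ j → q j xor q' j) ≡ digit q +₄ digit q'
digit-xor q q' =
  cong₂ _,_ (xor-interchange (q b₁) (q' b₁) (q b₃) (q' b₃)) (xor-interchange (q b₂) (q' b₂) (q b₃) (q' b₃))

Σ₃-⊕ : ∀ {m} (g h : Block → Word m) → Σ₃ (λ j → g j ⊕ h j) ≡ Σ₃ g ⊕ Σ₃ h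
Σ₃-⊕ g h = trans (cong (g b₁ ⊕ h b₁ ⊕_) (interchange (g b₂) (h b₂) (g b₃) (h b₃)))
  (interchange (g b₁) (h b₁) (g b₂ ⊕ g b₃) (h b₂ ⊕ h b₃))
  where open ⊕-Rearrange using (interchange)

L-⊻ : ∀ m (x c : Vec Bool (3 ^ m)) → L m (x ⊻ c) ≡ L m x ⊕ L m c
L-⊻ zero x c = refl
L-⊻ (suc m) x c with thirds′ (3 ^ m) x | thirds′ (3 ^ m) c
... | thirds x₁ x₂ x₃ | thirds c₁ c₂ c₃ = begin
  L (suc m) (join X ⊻ join C)                         ≡⟨ cong (L (suc m)) (join-⊻ X C) ⟩
  L (suc m) (join (λ j → X j ⊻ C j))                  ≡⟨ L-join m (λ j → X j ⊻ C j) ⟩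
  digit (λ j → parity (X j ⊻ C j)) ∷ Σ₃ (λ j → L m (X j ⊻ C j))
    ≡⟨ cong₂ _∷_ (trans (digit-cong (λ j → parity-⊻ (X j) (C j))) (digit-xor (parity ∘ X) (parity ∘ C)))
                 (trans (cong₂ _⊕_ (L-⊻ m x₁ c₁) (cong₂ _⊕_ (L-⊻ m x₂ c₂) (L-⊻ m x₃ c₃)))
                        (Σ₃-⊕ (L m ∘ X) (L m ∘ C))) ⟩
  (digit (parity ∘ X) ∷ Σ₃ (L m ∘ X)) ⊕ (digit (parity ∘ C) ∷ Σ₃ (L m ∘ C))  ∎
  where
  open ≡-Reasoning
  X = triple x₁ x₂ x₃
  C = triple c₁ c₂ c₃

parity-evenEnd : ∀ {n} (e : Edge n) → parity (evenEnd e) ≡ false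
parity-evenEnd e = trans (Adj-parity (Adj-oddEnd-evenEnd e)) (cong not (parity-oddEnd e))

translate : ∀ {n} → Vec Bool n → Edge n → Edge n
translate c e = toEdge (Adj-⊻ c (Adj-oddEnd-evenEnd e))

translate-ends : ∀ {n} (c : Vec Bool n) e → parity c ≡ false →
  oddEnd (translate c e) ≡ oddEnd e ⊻ c × evenEnd (translate c e) ≡ evenEnd e ⊻ c
translate-ends c e even-c with toEdge-isEnd (Adj-⊻ c (Adj-oddEnd-evenEnd e))
... | odd-end , even-end =
  oddEnd-unique (translate c e) odd-end (trans (parity-⊻ (oddEnd e) c) (cong₂ _xor_ (parity-oddEnd e) even-c)) ,
  evenEnd-unique (translate c e) even-end (trans (parity-⊻ (evenEnd e) c) (cong₂ _xor_ (parity-evenEnd e) even-c))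

translate-involutive : ∀ {n} (c : Vec Bool n) e → parity c ≡ false → translate c (translate c e) ≡ e
translate-involutive c e even-c = edge-≡
  (trans (proj₁ ends₂) (trans (cong (_⊻ c) (proj₁ ends₁)) (⊻-cancelʳ _ c)))
  (trans (proj₂ ends₂) (trans (cong (_⊻ c) (proj₂ ends₁)) (⊻-cancelʳ _ c)))
  where
  ends₁ = translate-ends c e even-c
  ends₂ = translate-ends c (translate c e) even-c

edgeLabel-translate : ∀ m (c : Vec Bool (3 ^ m)) e → parity c ≡ false → edgeLabel m (translate c e) ≡ edgeLabel m e ⊕ L m c
edgeLabel-translate m c e even-c = begin
  edgeLabel m (translate c e)                           ≡⟨ cong₂ (λ x y → L m x ⋈ᵥ L m y) odd≡ even≡ ⟩
  L m (oddEnd e ⊻ c) ⋈ᵥ L m (evenEnd e ⊻ c)             ≡⟨ cong₂ _⋈ᵥ_ (L-⊻ m _ c) (L-⊻ m _ c) ⟩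
  (L m (oddEnd e) ⊕ L m c) ⋈ᵥ (L m (evenEnd e) ⊕ L m c)  ≡⟨ ⋈ᵥ-translate _ _ (L m c) ⟩
  edgeLabel m e ⊕ L m c                                 ∎
  where
  open ≡-Reasoning
  odd≡ = proj₁ (translate-ends c e even-c)
  even≡ = proj₂ (translate-ends c e even-c)

-- The matchings

vertices : ∀ n → List (Vec Bool n)
vertices zero = List.[ [] ]
vertices (suc n) = List.map (false ∷_) (vertices n) List.++ List.map (true ∷_) (vertices n)

∈-vertices : ∀ {n} (v : Vec Bool n) → v ∈ vertices n
∈-vertices [] = here refl
∈-vertices (false ∷ v) = ∈-++⁺ˡ (∈-map⁺ (false ∷_) (∈-vertices v))
∈-vertices {suc n} (true ∷ v) = ∈-++⁺ʳ (List.map (false ∷_) (vertices n)) (∈-map⁺ (true ∷_) (∈-vertices v))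

extend : ∀ {n} → Bool → Edge n → Edge (suc n)
extend b e = edge (b ∷ base e) (suc (dir e)) (low e)

firstCoordinate : ∀ {n} → Vec Bool n → Edge (suc n)
firstCoordinate v = edge (false ∷ v) zero refl

edges : ∀ n → List (Edge n)
edges zero = List.[]
edges (suc n) =
  List.map firstCoordinate (vertices n) List.++ (List.map (extend false) (edges n) List.++ List.map (extend true) (edges n))

∈-edges : ∀ {n} (e : Edge n) → e ∈ edges n
∈-edges (edge (false ∷ v) zero refl) = ∈-++⁺ˡ (∈-map⁺ firstCoordinate (∈-vertices v))
∈-edges {suc n} (edge (false ∷ v) (suc i) p) =
  ∈-++⁺ʳ (List.map firstCoordinate (vertices n)) (∈-++⁺ˡ (∈-map⁺ (extend false) (∈-edges (edge v i p))))
∈-edges {suc n} (edge (true ∷ v) (suc i) p) =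
  ∈-++⁺ʳ (List.map firstCoordinate (vertices n))
    (∈-++⁺ʳ (List.map (extend false) (edges n)) (∈-map⁺ (extend true) (∈-edges (edge v i p))))

_≟ᵉ_ : ∀ {n} → DecidableEquality (Edge n)
edge b d p ≟ᵉ edge b' d' p' with ≡-decᵥ Bool._≟_ b b' | d Fin.≟ d'
... | yes refl | yes refl = yes (cong (edge b d) (Decidable⇒UIP.≡-irrelevant Bool._≟_ p p'))
... | no b≢b' | _ = no (b≢b' ∘ cong base)
... | yes _ | no d≢d' = no (d≢d' ∘ cong dir)

_≟ʷ_ : ∀ {m} → DecidableEquality (Word m)
_≟ʷ_ = ≡-decᵥ _≟₄_

dim-replicate : ∀ n → dim (replicate n nothing) ≡ n
dim-replicate zero = refl
dim-replicate (suc n) = cong suc (dim-replicate n)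

evenVertex : ∀ m (s : Word m) → LabelledVertex m (replicate (3 ^ m) nothing) false s
evenVertex m s = every-vertex-label m (replicate _ nothing) large false s
  where
  large : 2 * 3 ^ m < 3 * dim (replicate (3 ^ m) nothing)
  large rewrite dim-replicate (3 ^ m) = m<n+m (2 * 3 ^ m) (m^n>0 3 m)

zeroMatching : ∀ m → List (Edge (3 ^ m))
zeroMatching m = deduplicate _≟ᵉ_ (filter (λ e → edgeLabel m e ≟ʷ 0ᵥ) (edges (3 ^ m)))

-- Translation by an even vertex of label s carries the edges of label 0 onto those of label s.
matching : ∀ m → Word m → List (Edge (3 ^ m))
matching m s = List.map (translate (vertex (evenVertex m s))) (zeroMatching m)

∈-matching⁻ : ∀ m s {e} → e ∈ matching m s → edgeLabel m e ≡ s
∈-matching⁻ m s e∈M with ∈-map⁻ (translate (vertex (evenVertex m s))) e∈M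
... | e₀ , e₀∈M₀ , refl = begin
  edgeLabel m (translate c e₀)  ≡⟨ edgeLabel-translate m c e₀ (parity≡ (evenVertex m s)) ⟩
  edgeLabel m e₀ ⊕ L m c        ≡⟨ cong₂ _⊕_ label₀ (label≡ (evenVertex m s)) ⟩
  0ᵥ ⊕ s                        ≡⟨ ⊕-identityˡ s ⟩
  s                             ∎
  where
  open ≡-Reasoning
  c = vertex (evenVertex m s)
  label₀ = proj₂ (∈-filter⁻ (λ e → edgeLabel m e ≟ʷ 0ᵥ) {xs = edges (3 ^ m)} (∈-deduplicate⁻ _≟ᵉ_ _ e₀∈M₀))

∈-matching⁺ : ∀ m s {e} → edgeLabel m e ≡ s → e ∈ matching m s
∈-matching⁺ m s {e} label≡s = subst (_∈ matching m s) (translate-involutive c e even)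
  (∈-map⁺ (translate c) (∈-deduplicate⁺ _≟ᵉ_ (∈-filter⁺ (λ e → edgeLabel m e ≟ʷ 0ᵥ) (∈-edges (translate c e)) label₀)))
  where
  c = vertex (evenVertex m s)
  even = parity≡ (evenVertex m s)
  label₀ : edgeLabel m (translate c e) ≡ 0ᵥ
  label₀ = trans (edgeLabel-translate m c e even) (trans (cong₂ _⊕_ label≡s (label≡ (evenVertex m s))) (⊕-self s))

matching-unique : ∀ m s → Unique (matching m s)
matching-unique m s = map⁺ translate-injective (deduplicate-! _≟ᵉ_ _)
  where
  c = vertex (evenVertex m s)
  even = parity≡ (evenVertex m s)
  translate-injective : ∀ {e f} → translate c e ≡ translate c f → e ≡ f
  translate-injective {e} {f} eq =
    trans (sym (translate-involutive c e even)) (trans (cong (translate c) eq) (translate-involutive c f even))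

AllPairs-zipWith : ∀ {A : Set} {P : A → Set} {R S : A → A → Set} {xs} →
  (∀ {x y} → P x → P y → R x y → S x y) → All P xs → AllPairs R xs → AllPairs S xs
AllPairs-zipWith f [] [] = []
AllPairs-zipWith f (px ∷ pxs) (rx ∷ rxs) = All.zipWith (λ (py , r) → f px py r) (pxs , rx) ∷ AllPairs-zipWith f pxs rxs

matching-isMatching : ∀ m s → IsMatching (matching m s)
matching-isMatching m s = AllPairs-zipWith
  (λ {e} {f} label-e label-f e≢f share → e≢f (same-label-sharing m e f (trans label-e (sym label-f)) share))
  (All.tabulate (∈-matching⁻ m s)) (matching-unique m s)

fromFin₄ : Fin 4 → F₄
fromFin₄ zero = false , false
fromFin₄ (suc zero) = true , false
fromFin₄ (suc (suc zero)) = false , true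
fromFin₄ (suc (suc (suc zero))) = true , true

toFin₄ : F₄ → Fin 4
toFin₄ (false , false) = zero
toFin₄ (true , false) = suc zero
toFin₄ (false , true) = suc (suc zero)
toFin₄ (true , true) = suc (suc (suc zero))

fromFin₄-toFin₄ : ∀ x → fromFin₄ (toFin₄ x) ≡ x
fromFin₄-toFin₄ (false , false) = refl
fromFin₄-toFin₄ (true , false) = refl
fromFin₄-toFin₄ (false , true) = refl
fromFin₄-toFin₄ (true , true) = refl

toFin₄-fromFin₄ : ∀ i → toFin₄ (fromFin₄ i) ≡ i
toFin₄-fromFin₄ zero = refl
toFin₄-fromFin₄ (suc zero) = refl
toFin₄-fromFin₄ (suc (suc zero)) = refl
toFin₄-fromFin₄ (suc (suc (suc zero))) = refl

toWord : ∀ m → Fin (4 ^ m) → Word m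
consWord : ∀ m → Fin 4 × Fin (4 ^ m) → Word (suc m)
toWord zero _ = []
toWord (suc m) i = consWord m (Fin.remQuot (4 ^ m) i)
consWord m (a , b) = fromFin₄ a ∷ toWord m b

fromWord : ∀ m → Word m → Fin (4 ^ m)
fromWord zero [] = zero
fromWord (suc m) (x ∷ w) = Fin.combine (toFin₄ x) (fromWord m w)

toWord-fromWord : ∀ m w → toWord m (fromWord m w) ≡ w
toWord-fromWord zero [] = refl
toWord-fromWord (suc m) (x ∷ w) = trans (cong (consWord m) (remQuot-combine (toFin₄ x) (fromWord m w)))
  (cong₂ _∷_ (fromFin₄-toFin₄ x) (toWord-fromWord m w))

fromWord-toWord : ∀ m i → fromWord m (toWord m i) ≡ i
fromWord-toWord zero zero = refl
fromWord-toWord (suc m) i = trans (from-pair (Fin.remQuot (4 ^ m) i)) (combine-remQuot {4} (4 ^ m) i)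
  where
  from-pair : ∀ p → fromWord (suc m) (consWord m p) ≡ uncurry Fin.combine p
  from-pair (a , b) = cong₂ Fin.combine (toFin₄-fromFin₄ a) (fromWord-toWord m b)

toWord-injective : ∀ m {i j} → toWord m i ≡ toWord m j → i ≡ j
toWord-injective m {i} {j} eq = trans (sym (fromWord-toWord m i)) (trans (cong (fromWord m) eq) (fromWord-toWord m j))

odd-labelledEdge⇒edge : ∀ {m S s} → LabelledEdge m S true s →
  ∃ λ e → edgeLabel m e ≡ s × lowEnd e ∈ₛ S × highEnd e ∈ₛ S
odd-labelledEdge⇒edge {m} {S} (labelledEdge {u} {u'} u∈S u'∈S adj odd label≡u) = toEdge adj , label≡e , ends
  where
  isEnd = toEdge-isEnd adj
  odd≡ : oddEnd (toEdge adj) ≡ u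
  odd≡ = oddEnd-unique (toEdge adj) (proj₁ isEnd) odd
  even≡ : evenEnd (toEdge adj) ≡ u'
  even≡ = evenEnd-unique (toEdge adj) (proj₂ isEnd) (trans (Adj-parity adj) (cong not odd))
  label≡e : edgeLabel m (toEdge adj) ≡ _
  label≡e = trans (cong₂ (λ x y → L m x ⋈ᵥ L m y) odd≡ even≡) label≡u
  ends : lowEnd (toEdge adj) ∈ₛ S × highEnd (toEdge adj) ∈ₛ S
  ends with toEdge-ends adj
  ... | inj₁ (low≡ , high≡) = subst (_∈ₛ S) (sym low≡) (∈ᶜ⇒∈ₛ u∈S) , subst (_∈ₛ S) (sym high≡) (∈ᶜ⇒∈ₛ u'∈S)
  ... | inj₂ (low≡ , high≡) = subst (_∈ₛ S) (sym low≡) (∈ᶜ⇒∈ₛ u'∈S) , subst (_∈ₛ S) (sym high≡) (∈ᶜ⇒∈ₛ u∈S)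

matching-isPairingStrategy : ∀ m s → IsPairingStrategy (3 ^ suc m) (3 ^ m + 1) (matching (suc m) s)
matching-isPairingStrategy m s = matching-isMatching (suc m) s , covered
  where
  covered : ∀ S → dim S ≡ 3 ^ m + 1 → ∃ λ e → e ∈ matching (suc m) s × lowEnd e ∈ₛ S × highEnd e ∈ₛ S
  covered S dim≡ =
    let e , label≡ , ends = odd-labelledEdge⇒edge (every-edge-label (suc m) S large true s)
    in e , ∈-matching⁺ (suc m) s label≡ , ends
    where
    large : 3 ^ suc m < 3 * dim S
    large rewrite dim≡ = *-monoʳ-< 3 (m<m+n (3 ^ m) z<s)

theorem10 : (d : ℕ) →
    Σ (Fin (4 ^ (d + 1)) → List (Edge (3 ^ (d + 1)))) λ M →
      (∀ i → IsPairingStrategy (3 ^ (d + 1)) (3 ^ d + 1) (M i)) ×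
      (∀ i j → i ≢ j → ∀ e → e ∈ M i → e ∈ M j → ⊥) ×
      (∃ λ m → ∀ i → length (M i) ≡ m) ×
      (∀ (e : Edge (3 ^ (d + 1))) → ∃ λ i → e ∈ M i)
theorem10 d rewrite +-comm d 1 =
  M , (λ i → matching-isPairingStrategy d (toWord (suc d) i)) , disjoint ,
  (length (zeroMatching (suc d)) , λ i → length-map _ (zeroMatching (suc d))) , covering
  where
  M : Fin (4 ^ suc d) → List (Edge (3 ^ suc d))
  M i = matching (suc d) (toWord (suc d) i)
  disjoint : ∀ i j → i ≢ j → ∀ e → e ∈ M i → e ∈ M j → ⊥
  disjoint i j i≢j e e∈i e∈j =
    i≢j (toWord-injective (suc d) (trans (sym (∈-matching⁻ _ _ e∈i)) (∈-matching⁻ _ _ e∈j)))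
  covering : ∀ e → ∃ λ i → e ∈ M i
  covering e = fromWord (suc d) (edgeLabel (suc d) e) , ∈-matching⁺ (suc d) _ (sym (toWord-fromWord (suc d) _))
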